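{- For every reactive Turing machine $M=(S,\to,\uparrow,\downarrow)$, $\mathcal{T}(M)\leftrightarrow_b^\Delta\mathcal{T}_{E_{fc}\cup E_T^\infty}([C_{\uparrow,\Box}\parallel T_{\check\Box}]_{\{r,w,m\}})$.
   Context: Fix a finite set $\mathcal{A}$ of actions, $\tau\notin\mathcal{A}$, $\mathcal{A}_\tau=\mathcal{A}\cup\{\tau\}$, a finite data set $\mathcal{D}$ with blank $\Box\notin\mathcal{D}$, $\mathcal{D}_\Box=\mathcal{D}\cup\{\Box\}$; channels $r,w,m$ carry values in $\mathcal{D}_\Box\cup\{L,R\}$, and the actions of $M$ are not communication actions on $r,w,m$. RTM: $M=(S,\to,\uparrow,\downarrow)$ with $S$ finite, $\uparrow\in S$, $\downarrow\subseteq S$, $\to\subseteq S\times\mathcal{D}_\Box\times\mathcal{A}_\tau\times\mathcal{D}_\Box\times\{L,R\}\times S$. Tape instances: finite sequences over $\mathcal{D}_\Box$ and marked symbols $\check d$ with exactly one marked symbol, identified modulo blanks at the ends; for $\delta\in\mathcal{D}_\Box^*$, $\overleftarrow{\delta}$ (resp. $\overrightarrow{\delta}$) marks its rightmost (resp. leftmost) symbol, or is $\check\Box$ if $\delta$ is empty. $\mathcal{T}(M)$ has states $(s,\delta)$, transitions $(s,\delta_L\check d\delta_R)\xrightarrow{a}(t,\overleftarrow{\delta_L}e\delta_R)$ iff $(s,d,a,e,L,t)\in\to$ and $(s,\delta_L\check d\delta_R)\xrightarrow{a}(t,\delta_Le\overrightarrow{\delta_R})$ iff $(s,d,a,e,R,t)\in\to$,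 initial state $(\uparrow,\check\Box)$, final states $\{(s,\delta)\mid s\in\downarrow\}$. Process calculus: for channels $C'$, $I_{C'}=\{c?v,c!v\mid c\in C'\}$. Expressions $p::=0\mid 1\mid a.p\mid p+p\mid[p\parallel p]_{C'}\mid X$; recursive specifications $E$ are sets of equations $X\stackrel{def}{=}p$ (one per name, all used names defined). Rules ($p\downarrow$ = termination): $1\downarrow$; $a.p\xrightarrow{a}p$; $p+q$ has the transitions of $p$ and $q$ and terminates if either does; $[p\parallel q]_{C'}\xrightarrow{a}[p'\parallel q]_{C'}$ if $p\xrightarrow{a}p'$, $a\notin I_{C'}$, and symmetrically; $[p\parallel q]_{C'}\xrightarrow{\tau}[p'\parallel q']_{C'}$ if for some $c\in C'$ and $v$, $p\xrightarrow{c?v}p'$, $q\xrightarrow{c!v}q'$ or vice versa; $[p\parallel q]_{C'}\downarrow$ iff both terminate; names behave as their right-hand sides. $\mathcal{T}_E(p)$: expressions reachable from $p$, initial $p$, final those $q$ with $q\downarrow$. Tape $E_T^\infty$: $T_{\delta_L\check d\delta_R}\stackrel{def}{=}r!d.T_{\delta_L\check d\delta_R}+\sum_{e\in\mathcal{D}_\Box}w?e.T_{\delta_L\check e\delta_R}+m?L.T_{\overleftarrow{\delta_L}d\delta_R}+m?R.T_{\delta_Ld\overrightarrow{\delta_R}}+1$ for all $d,\delta_L,\delta_R$. Finite control $E_{fc}$: for all $s\in S$, $d\in\mathcal{D}_\Box$: $C_{s,d}\stackrel{def}{=}\sum_{(s,d,a,e,X,t)\in\to}a.w!e.m!X.\sum_{f\in\mathcal{D}_\Box}r?f.C_{t,f}$,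 with an additional summand $+1$ iff $s\in\downarrow$. Divergence-preserving branching bisimilarity $\leftrightarrow_b^\Delta$: write $s\xrightarrow{(a)}t$ if $s\xrightarrow{a}t$ or ($a=\tau$ and $s=t$); $\twoheadrightarrow$ / $\twoheadrightarrow^+$ are reflexive-transitive / transitive closures of $\xrightarrow{\tau}$. A relation $\mathcal{R}$ is a divergence-preserving branching bisimulation if $s_1\mathcal{R}s_2$ implies: (1) $s_1\xrightarrow{a}s_1'$ gives $s_2\twoheadrightarrow s_2''\xrightarrow{(a)}s_2'$ with $s_1\mathcal{R}s_2''$, $s_1'\mathcal{R}s_2'$; (2) symmetrically; (3) if $s_1$ final then $s_2\twoheadrightarrow s_2'$ final with $s_1\mathcal{R}s_2'$; (4) symmetrically; (5) an infinite $\tau$-sequence from $s_1$ with all states related to $s_2$ gives $s_2\twoheadrightarrow^+s_2'$ with $s_2'$ related to some state of the sequence; (6) symmetrically. Two transition systems are $\leftrightarrow_b^\Delta$ if such a relation relates their initial states. -}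

module Defs where

open import Data.Nat using (ℕ; zero; suc)
open import Data.Fin using (Fin)
open import Data.Fin.Properties using () renaming (_≟_ to _≟F_)
open import Data.Bool using (Bool; true; false)
open import Data.List using (List; []; _∷_; map; filter; allFin)
open import Data.List.Membership.Propositional using (_∈_)
open import Data.Product using (Σ; ∃; ∃-syntax; _×_; _,_; proj₁; proj₂)
open import Data.Product.Relation.Binary.Pointwise.NonDependent using ()
open import Data.Sum using (_⊎_)
open import Relation.Nullary using (¬_; Dec; yes; no)
open import Relation.Nullary.Decidable using (_×-dec_; map′)
open import Relation.Binary.PropositionalEquality using (_≡_; refl; cong)
open import Relation.Binary.Construct.Closure.ReflexiveTransitive using (Star)

-- Data symbols: D = Fin nD, D□ = Sym nD (blank or a datum)

data Sym (nD : ℕ) : Set where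
  blank : Sym nD
  dat   : Fin nD → Sym nD

_≟S_ : ∀ {nD} (x y : Sym nD) → Dec (x ≡ y)
blank ≟S blank = yes refl
blank ≟S dat _ = no λ ()
dat _ ≟S blank = no λ ()
dat x ≟S dat y with x ≟F y
... | yes refl = yes refl
... | no x≢y = no λ { refl → x≢y refl }

allSym : ∀ nD → List (Sym nD)
allSym nD = blank ∷ map dat (allFin nD)

data Dir : Set where
  L R : Dir

data Chan : Set where
  r w m : Chan

data Val (nD : ℕ) : Set where
  sym : Sym nD → Val nD
  dir : Dir → Val nD

data Actτ (nA : ℕ) : Set where
  act : Fin nA → Actτ nA
  tau : Actτ nA

data Lab (nA nD : ℕ) : Set where
  base : Actτ nA → Lab nA nD
  recv : Chan → Val nD → Lab nA nD
  send : Chan → Val nD → Lab nA nD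

τ : ∀ {nA nD} → Lab nA nD
τ = base tau

record LTS (nA nD : ℕ) : Set₁ where
  field
    State : Set
    _—[_]→_ : State → Lab nA nD → State → Set
    init : State
    Final : State → Set

module _ {nA nD : ℕ} (T : LTS nA nD) where
  open LTS T

  OptStep : State → Lab nA nD → State → Set
  OptStep s a t = (s —[ a ]→ t) ⊎ (a ≡ τ × s ≡ t)

  TauStep : State → State → Set
  TauStep s t = s —[ τ ]→ t

  Taus : State → State → Set
  Taus = Star TauStep

  Taus⁺ : State → State → Set
  Taus⁺ s t = ∃[ u ] (TauStep s u × Taus u t)

record IsDPBB {nA nD : ℕ} (T₁ T₂ : LTS nA nD)
              (ℛ : LTS.State T₁ → LTS.State T₂ → Set) : Set where
  open LTS T₁ renaming (State to S₁; _—[_]→_ to _⟶₁[_]_; Final to F₁)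
  open LTS T₂ renaming (State to S₂; _—[_]→_ to _⟶₂[_]_; Final to F₂)
  field
    cond1 : ∀ {s₁ s₂ a s₁'} → ℛ s₁ s₂ → s₁ ⟶₁[ a ] s₁' →
            ∃[ s₂'' ] ∃[ s₂' ] (Taus T₂ s₂ s₂'' × OptStep T₂ s₂'' a s₂'
                                × ℛ s₁ s₂'' × ℛ s₁' s₂')
    cond2 : ∀ {s₁ s₂ a s₂'} → ℛ s₁ s₂ → s₂ ⟶₂[ a ] s₂' →
            ∃[ s₁'' ] ∃[ s₁' ] (Taus T₁ s₁ s₁'' × OptStep T₁ s₁'' a s₁'
                                × ℛ s₁'' s₂ × ℛ s₁' s₂')
    cond3 : ∀ {s₁ s₂} → ℛ s₁ s₂ → F₁ s₁ →
            ∃[ s₂' ] (Taus T₂ s₂ s₂' × F₂ s₂' × ℛ s₁ s₂')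
    cond4 : ∀ {s₁ s₂} → ℛ s₁ s₂ → F₂ s₂ →
            ∃[ s₁' ] (Taus T₁ s₁ s₁' × F₁ s₁' × ℛ s₁' s₂)
    cond5 : ∀ {s₁ s₂} → ℛ s₁ s₂ → (f : ℕ → S₁) → f 0 ≡ s₁ →
            (∀ n → f n ⟶₁[ τ ] f (suc n)) → (∀ n → ℛ (f n) s₂) →
            ∃[ s₂' ] (Taus⁺ T₂ s₂ s₂' × ∃[ k ] ℛ (f k) s₂')
    cond6 : ∀ {s₁ s₂} → ℛ s₁ s₂ → (g : ℕ → S₂) → g 0 ≡ s₂ →
            (∀ n → g n ⟶₂[ τ ] g (suc n)) → (∀ n → ℛ s₁ (g n)) →
            ∃[ s₁' ] (Taus⁺ T₁ s₁ s₁' × ∃[ k ] ℛ s₁' (g k))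

_↔bΔ_ : ∀ {nA nD} → LTS nA nD → LTS nA nD → Set₁
T₁ ↔bΔ T₂ = ∃[ ℛ ] (IsDPBB T₁ T₂ ℛ × ℛ (LTS.init T₁) (LTS.init T₂))

-- Tape instances, in canonical form modulo blanks at the ends.
-- A half tape (read outward from the head) is either empty or a list of
-- symbols followed by a final non-blank datum (the outermost symbol).

data Half (nD : ℕ) : Set where
  emp : Half nD
  ne  : List (Sym nD) → Fin nD → Half nD

record Tape (nD : ℕ) : Set where
  constructor tape
  field
    left  : Half nD      -- δ_L, nearest-to-head symbol first
    head  : Sym nD
    right : Half nD      -- δ_R, nearest-to-head symbol first
open Tape public

pop : ∀ {nD} → Half nD → Sym nD × Half nD
pop emp = blank , emp
pop (ne [] y) = dat y , emp
pop (ne (x ∷ xs) y) = x , ne xs y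

push : ∀ {nD} → Sym nD → Half nD → Half nD
push blank emp = emp
push (dat x) emp = ne [] x
push s (ne xs y) = ne (s ∷ xs) y

blankTape : ∀ {nD} → Tape nD
blankTape = tape emp blank emp

write : ∀ {nD} → Sym nD → Tape nD → Tape nD
write e (tape l _ rr) = tape l e rr

moveL : ∀ {nD} → Tape nD → Tape nD
moveL (tape l d rr) = tape (proj₂ (pop l)) (proj₁ (pop l)) (push d rr)

moveR : ∀ {nD} → Tape nD → Tape nD
moveR (tape l d rr) = tape (push d l) (proj₁ (pop rr)) (proj₂ (pop rr))

move : ∀ {nD} → Dir → Tape nD → Tape nD
move L = moveL
move R = moveR

record Trans (nA nD nS : ℕ) : Set where
  constructor trans
  field
    src : Fin nS
    rd  : Sym nD
    lab : Actτ nA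
    wr  : Sym nD
    dr  : Dir
    tgt : Fin nS
open Trans public

record RTM (nA nD : ℕ) : Set where
  field
    nS    : ℕ
    step  : List (Trans nA nD nS)
    start : Fin nS
    fin   : Fin nS → Bool

𝒯 : ∀ {nA nD} → RTM nA nD → LTS nA nD
𝒯 {nA} {nD} M = record
  { State = Fin (RTM.nS M) × Tape nD
  ; _—[_]→_ = λ { (s , δ) a (t , δ') →
      ∃[ tr ] (tr ∈ RTM.step M × src tr ≡ s × rd tr ≡ head δ ×
               a ≡ base (lab tr) × tgt tr ≡ t ×
               δ' ≡ move (dr tr) (write (wr tr) δ)) }
  ; init = RTM.start M , blankTape
  ; Final = λ { (s , _) → RTM.fin M s ≡ true }
  }

data Expr (nA nD : ℕ) (N : Set) : Set where
  𝟘 𝟙  : Expr nA nD N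
  _·_  : Lab nA nD → Expr nA nD N → Expr nA nD N
  _⊕_  : Expr nA nD N → Expr nA nD N → Expr nA nD N
  par  : List Chan → Expr nA nD N → Expr nA nD N → Expr nA nD N
  name : N → Expr nA nD N

infixr 6 _·_
infixr 5 _⊕_

InI : ∀ {nA nD} → List Chan → Lab nA nD → Set
InI {nD = nD} C' a = ∃[ c ] ∃[ v ] (c ∈ C' × (a ≡ recv {nD = nD} c v ⊎ a ≡ send c v))

module Semantics {nA nD : ℕ} {N : Set} (E : N → Expr nA nD N) where

  data _↓ : Expr nA nD N → Set where
    one  : 𝟙 ↓
    sumL : ∀ {p q} → p ↓ → (p ⊕ q) ↓
    sumR : ∀ {p q} → q ↓ → (p ⊕ q) ↓
    parT : ∀ {C' p q} → p ↓ → q ↓ → par C' p q ↓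
    nmT  : ∀ {X} → E X ↓ → name X ↓

  data _⟶[_]_ : Expr nA nD N → Lab nA nD → Expr nA nD N → Set where
    pre   : ∀ {a p} → (a · p) ⟶[ a ] p
    sumL  : ∀ {p q a p'} → p ⟶[ a ] p' → (p ⊕ q) ⟶[ a ] p'
    sumR  : ∀ {p q a q'} → q ⟶[ a ] q' → (p ⊕ q) ⟶[ a ] q'
    parL  : ∀ {C' p q a p'} → p ⟶[ a ] p' → ¬ InI C' a →
            par C' p q ⟶[ a ] par C' p' q
    parR  : ∀ {C' p q a q'} → q ⟶[ a ] q' → ¬ InI C' a →
            par C' p q ⟶[ a ] par C' p q'
    comm₁ : ∀ {C' p q p' q' c v} → c ∈ C' →
            p ⟶[ recv c v ] p' → q ⟶[ send c v ] q' →
            par C' p q ⟶[ τ ] par C' p' q'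
    comm₂ : ∀ {C' p q p' q' c v} → c ∈ C' →
            p ⟶[ send c v ] p' → q ⟶[ recv c v ] q' →
            par C' p q ⟶[ τ ] par C' p' q'
    nm    : ∀ {X a p'} → E X ⟶[ a ] p' → name X ⟶[ a ] p'

  Reach : Expr nA nD N → Expr nA nD N → Set
  Reach = Star (λ p q → ∃[ a ] (p ⟶[ a ] q))

  𝒯E : Expr nA nD N → LTS nA nD
  𝒯E p = record
    { State = Σ (Expr nA nD N) (Reach p)
    ; _—[_]→_ = λ q a q' → proj₁ q ⟶[ a ] proj₁ q'
    ; init = p , Star.ε
    ; Final = λ q → proj₁ q ↓
    }

Σ⊕ : ∀ {nA nD N} → List (Expr nA nD N) → Expr nA nD N
Σ⊕ [] = 𝟘
Σ⊕ (p ∷ []) = p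
Σ⊕ (p ∷ ps@(_ ∷ _)) = p ⊕ Σ⊕ ps

data Name (nD nS : ℕ) : Set where
  C : Fin nS → Sym nD → Name nD nS
  T : Tape nD → Name nD nS

module _ {nA nD : ℕ} (M : RTM nA nD) where
  private
    nS = RTM.nS M
    Ex = Expr nA nD (Name nD nS)

  summand : Trans nA nD nS → Ex
  summand tr = base (lab tr) · send w (sym (wr tr)) · send m (dir (dr tr)) ·
               Σ⊕ (map (λ f → recv r (sym f) · name (C (tgt tr) f)) (allSym nD))

  matches : Fin nS → Sym nD → Trans nA nD nS → Set
  matches s d tr = src tr ≡ s × rd tr ≡ d

  matches? : ∀ s d tr → Dec (matches s d tr)
  matches? s d tr = (src tr ≟F s) ×-dec (rd tr ≟S d)

  Cdef : Fin nS → Sym nD → Ex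
  Cdef s d with RTM.fin M s
  ... | true  = Σ⊕ (map summand (filter (matches? s d) (RTM.step M))) ⊕ 𝟙
  ... | false = Σ⊕ (map summand (filter (matches? s d) (RTM.step M)))

  Tdef : Tape nD → Ex
  Tdef δ = send r (sym (head δ)) · name (T δ)
         ⊕ Σ⊕ (map (λ e → recv w (sym e) · name (T (write e δ))) (allSym nD))
         ⊕ recv m (dir L) · name (T (moveL δ))
         ⊕ recv m (dir R) · name (T (moveR δ))
         ⊕ 𝟙

  Efc∪ET : Name nD nS → Ex
  Efc∪ET (C s d) = Cdef s d
  Efc∪ET (T δ) = Tdef δ

  initialExpr : Ex
  initialExpr = par (r ∷ w ∷ m ∷ []) (name (C (RTM.start M) blank)) (name (T blankTape))

  𝒯spec : LTS nA nD
  𝒯spec = Semantics.𝒯E Efc∪ET initialExpr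

module Submission where

-- The encoding [C_{↑,□} ∥ T_{□̌}]_{r,w,m} simulates one RTM transition
-- (s, δ_L ď δ_R) —a→ (t, δ') by a cycle of four shapes of the parallel
-- composition: the control performs a (Ready), then synchronises with the tape
-- on w (Writing), on m (Moving) and on r (Reading), returning to Ready.
-- Relating each configuration of 𝒯(M) with the Ready/Writing/Moving/Reading
-- expressions that "represent" it gives a divergence-preserving branching
-- bisimulation: every administrative step is a τ that keeps the represented
-- configuration, and only a Ready expression carries observable behaviour.

open import Defs
open import Data.Nat using (ℕ; zero; suc)
open import Data.Nat.Properties using (suc-injective; 0≢1+n)
open import Data.Fin using (Fin)
open import Data.Bool using (true; false)
open import Data.List using (List; []; _∷_; map; filter)
open import Data.List.Membership.Propositional using (_∈_)
open import Data.List.Membership.Propositional.Properties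
  using (∈-map⁺; ∈-filter⁺; ∈-filter⁻; ∈-allFin)
open import Data.List.Relation.Unary.Any using (here; there)
open import Data.Product using (Σ; ∃-syntax; _×_; _,_; proj₁)
open import Data.Sum using (_⊎_; inj₁; inj₂)
open import Data.Empty using (⊥-elim)
open import Relation.Nullary using (¬_)
open import Relation.Binary.PropositionalEquality
  using (_≡_; refl) renaming (sym to ≡-sym; trans to ≡-trans)
open import Relation.Binary.Construct.Closure.ReflexiveTransitive
  using (Star; ε; _◅_; _◅◅_)

taus-then-step : ∀ {nA nD} (Sys : LTS nA nD) {s u t : LTS.State Sys} →
                 Taus Sys s u → TauStep Sys u t → Taus⁺ Sys s t
taus-then-step Sys ε       step = _ , step , ε
taus-then-step Sys (h ◅ p) step = _ , h , p ◅◅ (step ◅ ε)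

allSym-complete : ∀ {nD} (f : Sym nD) → f ∈ allSym nD
allSym-complete blank   = here refl
allSym-complete (dat x) = there (∈-map⁺ dat (∈-allFin x))

module SpecificationFacts {nA nD : ℕ} {N : Set} (E : N → Expr nA nD N) where
  open Semantics E

  private
    Ex : Set
    Ex = Expr nA nD N

  guarded : {X : Set} → (X → Lab nA nD) → (X → Ex) → List X → Ex
  guarded α κ xs = Σ⊕ (map (λ x → α x · κ x) xs)

  guarded-inv : {X : Set} (α : X → Lab nA nD) (κ : X → Ex) (xs : List X) {a : Lab nA nD} {q : Ex} →
                guarded α κ xs ⟶[ a ] q → ∃[ x ] (x ∈ xs × a ≡ α x × q ≡ κ x)
  guarded-inv α κ (x ∷ [])     pre        = x , here refl , refl , refl
  guarded-inv α κ (x ∷ y ∷ xs) (sumL pre) = x , here refl , refl , refl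
  guarded-inv α κ (x ∷ y ∷ xs) (sumR st) with guarded-inv α κ (y ∷ xs) st
  ... | z , z∈ , a≡ , q≡ = z , there z∈ , a≡ , q≡

  guarded-step : {X : Set} (α : X → Lab nA nD) (κ : X → Ex) {xs : List X} {x : X} →
                 x ∈ xs → guarded α κ xs ⟶[ α x ] κ x
  guarded-step α κ {_ ∷ []}    (here refl) = pre
  guarded-step α κ {_ ∷ _ ∷ _} (here refl) = sumL pre
  guarded-step α κ {_ ∷ _ ∷ _} (there x∈) = sumR (guarded-step α κ x∈)

  guarded-¬↓ : {X : Set} (α : X → Lab nA nD) (κ : X → Ex) (xs : List X) → ¬ (guarded α κ xs ↓)
  guarded-¬↓ α κ []           ()
  guarded-¬↓ α κ (x ∷ [])     ()
  guarded-¬↓ α κ (x ∷ y ∷ xs) (sumR t) = guarded-¬↓ α κ (y ∷ xs) t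

  _⟶τ*_ : Ex → Ex → Set
  _⟶τ*_ = Star (λ p q → p ⟶[ τ ] q)

  lift-taus : {p₀ q : Ex} (Q : LTS.State (𝒯E p₀)) → proj₁ Q ⟶τ* q →
              Σ (Reach p₀ q) λ ρ → Taus (𝒯E p₀) Q (q , ρ)
  lift-taus (p , ρ) ε          = ρ , ε
  lift-taus (p , ρ) (st ◅ sts) with lift-taus (_ , ρ ◅◅ ((τ , st) ◅ ε)) sts
  ... | ρ' , path = ρ' , st ◅ path

module Encoding {nA nD : ℕ} (M : RTM nA nD) where
  open Semantics (Efc∪ET M)
  open SpecificationFacts (Efc∪ET M)

  private
    S : Set
    S = Fin (RTM.nS M)
    Ex : Set
    Ex = Expr nA nD (Name nD (RTM.nS M))
    Conf : Set
    Conf = S × Tape nD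

  Machine : LTS nA nD
  Machine = 𝒯 M

  Spec : LTS nA nD
  Spec = 𝒯spec M

  C' : List Chan
  C' = r ∷ w ∷ m ∷ []

  Await : S → Ex
  Await t = guarded (λ f → recv r (sym f)) (λ f → name (C t f)) (allSym nD)

  afterAction : Trans nA nD (RTM.nS M) → Ex
  afterAction tr = send w (sym (wr tr)) · send m (dir (dr tr)) · Await (tgt tr)

  await-inv : ∀ {t a q} → Await t ⟶[ a ] q → ∃[ f ] (a ≡ recv r (sym f) × q ≡ name (C t f))
  await-inv {t} st with guarded-inv (λ f → recv r (sym f)) (λ f → name (C t f)) (allSym nD) st
  ... | f , _ , a≡ , q≡ = f , a≡ , q≡

  await-step : ∀ t f → Await t ⟶[ recv r (sym f) ] name (C t f)
  await-step t f = guarded-step (λ f → recv r (sym f)) (λ f → name (C t f)) (allSym-complete f)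

  await-¬↓ : ∀ t → ¬ (Await t ↓)
  await-¬↓ t = guarded-¬↓ (λ f → recv r (sym f)) (λ f → name (C t f)) (allSym nD)

  ControlStep : S → Sym nD → Lab nA nD → Ex → Set
  ControlStep s d a q = ∃[ tr ] (tr ∈ RTM.step M × src tr ≡ s × rd tr ≡ d ×
                                 a ≡ base (lab tr) × q ≡ afterAction tr)

  private
    enabled : S → Sym nD → Ex
    enabled s d = Σ⊕ (map (summand M) (filter (matches? M s d) (RTM.step M)))

    enabled-inv : ∀ {s d a q} → enabled s d ⟶[ a ] q → ControlStep s d a q
    enabled-inv {s} {d} st
      with guarded-inv (λ tr → base (lab tr)) afterAction (filter (matches? M s d) (RTM.step M)) st
    ... | tr , tr∈ , a≡ , q≡ with ∈-filter⁻ (matches? M s d) {xs = RTM.step M} tr∈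
    ... | tr∈step , src≡ , rd≡ = tr , tr∈step , src≡ , rd≡ , a≡ , q≡

    enabled-step : ∀ {s d} tr → tr ∈ RTM.step M → src tr ≡ s → rd tr ≡ d →
                   enabled s d ⟶[ base (lab tr) ] afterAction tr
    enabled-step {s} {d} tr tr∈ src≡ rd≡ =
      guarded-step (λ tr → base (lab tr)) afterAction (∈-filter⁺ (matches? M s d) tr∈ (src≡ , rd≡))

    definition-inv : ∀ {s d a q} → Cdef M s d ⟶[ a ] q → ControlStep s d a q
    definition-inv {s} st with RTM.fin M s | st
    ... | true  | sumL st' = enabled-inv st'
    ... | true  | sumR ()
    ... | false | st'      = enabled-inv st'

    definition-step : ∀ {s d} tr → tr ∈ RTM.step M → src tr ≡ s → rd tr ≡ d →
                      Cdef M s d ⟶[ base (lab tr) ] afterAction tr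
    definition-step {s} tr tr∈ src≡ rd≡ with RTM.fin M s
    ... | true  = sumL (enabled-step tr tr∈ src≡ rd≡)
    ... | false = enabled-step tr tr∈ src≡ rd≡

  control-inv : ∀ {s d a q} → name (C s d) ⟶[ a ] q → ControlStep s d a q
  control-inv (nm st) = definition-inv st

  control-step : ∀ {s d} tr → tr ∈ RTM.step M → src tr ≡ s → rd tr ≡ d →
                 name (C s d) ⟶[ base (lab tr) ] afterAction tr
  control-step tr tr∈ src≡ rd≡ = nm (definition-step tr tr∈ src≡ rd≡)

  control-final : ∀ s d → RTM.fin M s ≡ true → name (C s d) ↓
  control-final s d fin = nmT (definition-final fin)
    where
    definition-final : RTM.fin M s ≡ true → Cdef M s d ↓
    definition-final fin with RTM.fin M s
    definition-final refl | true = sumR one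

  control-final⁻ : ∀ s d → name (C s d) ↓ → RTM.fin M s ≡ true
  control-final⁻ s d (nmT t) = definition-final⁻ t
    where
    definition-final⁻ : Cdef M s d ↓ → RTM.fin M s ≡ true
    definition-final⁻ t with RTM.fin M s
    ... | true  = refl
    ... | false = ⊥-elim (guarded-¬↓ (λ tr → base (lab tr)) afterAction
                            (filter (matches? M s d) (RTM.step M)) t)

  data TapeStep (δ : Tape nD) : Lab nA nD → Ex → Set where
    reads  : TapeStep δ (send r (sym (head δ))) (name (T δ))
    writes : ∀ e → TapeStep δ (recv w (sym e)) (name (T (write e δ)))
    moves  : ∀ X → TapeStep δ (recv m (dir X)) (name (T (move X δ)))

  tape-inv : ∀ {δ a q} → name (T δ) ⟶[ a ] q → TapeStep δ a q
  tape-inv (nm (sumL pre)) = reads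
  tape-inv {δ} (nm (sumR (sumL st)))
    with guarded-inv (λ e → recv w (sym e)) (λ e → name (T (write e δ))) (allSym nD) st
  ... | e , _ , refl , refl = writes e
  tape-inv (nm (sumR (sumR (sumL pre))))        = moves L
  tape-inv (nm (sumR (sumR (sumR (sumL pre))))) = moves R

  -- The tape only communicates on r, w, m, so it never moves on its own.
  tape-internal : ∀ {δ a q} → TapeStep δ a q → InI C' a
  tape-internal reads      = r , _ , here refl , inj₂ refl
  tape-internal (writes e) = w , _ , there (here refl) , inj₁ refl
  tape-internal (moves X)  = m , _ , there (there (here refl)) , inj₁ refl

  tape-read : ∀ δ → name (T δ) ⟶[ send r (sym (head δ)) ] name (T δ)
  tape-read δ = nm (sumL pre)

  tape-write : ∀ δ e → name (T δ) ⟶[ recv w (sym e) ] name (T (write e δ))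
  tape-write δ e = nm (sumR (sumL (guarded-step (λ e → recv w (sym e))
                                     (λ e → name (T (write e δ))) (allSym-complete e))))

  tape-move : ∀ δ X → name (T δ) ⟶[ recv m (dir X) ] name (T (move X δ))
  tape-move δ L = nm (sumR (sumR (sumL pre)))
  tape-move δ R = nm (sumR (sumR (sumR (sumL pre))))

  tape-final : ∀ δ → name (T δ) ↓
  tape-final δ = nmT (sumR (sumR (sumR (sumR one))))

  base-external : ∀ {a} → ¬ InI {nA} {nD} C' (base a)
  base-external (_ , _ , _ , inj₁ ())
  base-external (_ , _ , _ , inj₂ ())

  Ready : S → Tape nD → Ex
  Ready s δ = par C' (name (C s (head δ))) (name (T δ))

  Writing : Sym nD → Dir → S → Tape nD → Ex
  Writing e X t δ = par C' (send w (sym e) · send m (dir X) · Await t) (name (T δ))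

  Moving : Dir → S → Tape nD → Ex
  Moving X t δ = par C' (send m (dir X) · Await t) (name (T δ))

  Reading : S → Tape nD → Ex
  Reading t δ = par C' (Await t) (name (T δ))

  data _≈_ : Conf → Ex → Set where
    ready   : ∀ s δ → (s , δ) ≈ Ready s δ
    writing : ∀ e X t δ → (t , move X (write e δ)) ≈ Writing e X t δ
    moving  : ∀ X t δ → (t , move X δ) ≈ Moving X t δ
    reading : ∀ t δ → (t , δ) ≈ Reading t δ

  -- Number of administrative τ-steps until the representative is Ready.
  rank : ∀ {x q} → x ≈ q → ℕ
  rank (ready _ _)       = 0
  rank (writing _ _ _ _) = 3
  rank (moving _ _ _)    = 2
  rank (reading _ _)     = 1

  ready-step : ∀ {s δ} tr → tr ∈ RTM.step M → src tr ≡ s → rd tr ≡ head δ →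
               Ready s δ ⟶[ base (lab tr) ] Writing (wr tr) (dr tr) (tgt tr) δ
  ready-step tr tr∈ src≡ rd≡ = parL (control-step tr tr∈ src≡ rd≡) base-external

  writing-step : ∀ e X t δ → Writing e X t δ ⟶[ τ ] Moving X t (write e δ)
  writing-step e X t δ = comm₂ (there (here refl)) pre (tape-write δ e)

  moving-step : ∀ X t δ → Moving X t δ ⟶[ τ ] Reading t (move X δ)
  moving-step X t δ = comm₂ (there (there (here refl))) pre (tape-move δ X)

  reading-step : ∀ t δ → Reading t δ ⟶[ τ ] Ready t δ
  reading-step t δ = comm₁ (here refl) (await-step t (head δ)) (tape-read δ)

  settle : ∀ {s δ q} → (s , δ) ≈ q → q ⟶τ* Ready s δ
  settle (ready s δ)       = ε
  settle (writing e X t δ) = writing-step e X t δ ◅ moving-step X t (write e δ) ◅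
                             reading-step t (move X (write e δ)) ◅ ε
  settle (moving X t δ)    = moving-step X t δ ◅ reading-step t (move X δ) ◅ ε
  settle (reading t δ)     = reading-step t δ ◅ ε

  ready-inv : ∀ {s δ a q} → Ready s δ ⟶[ a ] q →
              ∃[ tr ] (tr ∈ RTM.step M × src tr ≡ s × rd tr ≡ head δ × a ≡ base (lab tr) ×
                       q ≡ Writing (wr tr) (dr tr) (tgt tr) δ)
  ready-inv (parL st _) with control-inv st
  ... | tr , tr∈ , src≡ , rd≡ , a≡ , refl = tr , tr∈ , src≡ , rd≡ , a≡ , refl
  ready-inv (parR st internal) = ⊥-elim (internal (tape-internal (tape-inv st)))
  ready-inv (comm₁ _ st _) with control-inv st
  ... | _ , _ , _ , _ , () , _
  ready-inv (comm₂ _ st _) with control-inv st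
  ... | _ , _ , _ , _ , () , _

  writing-inv : ∀ {e X t δ a q} → Writing e X t δ ⟶[ a ] q → a ≡ τ × q ≡ Moving X t (write e δ)
  writing-inv (parL pre internal) = ⊥-elim (internal (w , _ , there (here refl) , inj₂ refl))
  writing-inv (parR st internal)  = ⊥-elim (internal (tape-internal (tape-inv st)))
  writing-inv (comm₁ _ () _)
  writing-inv (comm₂ _ pre st) with tape-inv st
  ... | writes e = refl , refl

  moving-inv : ∀ {X t δ a q} → Moving X t δ ⟶[ a ] q → a ≡ τ × q ≡ Reading t (move X δ)
  moving-inv (parL pre internal) = ⊥-elim (internal (m , _ , there (there (here refl)) , inj₂ refl))
  moving-inv (parR st internal)  = ⊥-elim (internal (tape-internal (tape-inv st)))
  moving-inv (comm₁ _ () _)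
  moving-inv (comm₂ _ pre st) with tape-inv st
  ... | moves X = refl , refl

  reading-inv : ∀ {t δ a q} → Reading t δ ⟶[ a ] q → a ≡ τ × q ≡ Ready t δ
  reading-inv (parL st internal) with await-inv st
  ... | _ , refl , _ = ⊥-elim (internal (r , _ , here refl , inj₁ refl))
  reading-inv (parR st internal) = ⊥-elim (internal (tape-internal (tape-inv st)))
  reading-inv (comm₁ _ st st') with await-inv st | tape-inv st'
  ... | _ , refl , refl | reads = refl , refl
  reading-inv (comm₂ _ st _) with await-inv st
  ... | _ , () , _

  _⇒[_]_ : Conf → Lab nA nD → Conf → Set
  x ⇒[ a ] y = LTS._—[_]→_ Machine x a y

  classify : ∀ {x q a q'} (rel : x ≈ q) → q ⟶[ a ] q' →
             (∃[ y ] (x ⇒[ a ] y × y ≈ q')) ⊎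
             (a ≡ τ × Σ (x ≈ q') λ rel' → rank rel ≡ suc (rank rel'))
  classify (ready s δ) st with ready-inv st
  ... | tr , tr∈ , src≡ , rd≡ , a≡ , refl =
    inj₁ (_ , (tr , tr∈ , src≡ , rd≡ , a≡ , refl , refl) , writing (wr tr) (dr tr) (tgt tr) δ)
  classify (writing e X t δ) st with writing-inv st
  ... | refl , refl = inj₂ (refl , moving X t (write e δ) , refl)
  classify (moving X t δ) st with moving-inv st
  ... | refl , refl = inj₂ (refl , reading t (move X δ) , refl)
  classify (reading t δ) st with reading-inv st
  ... | refl , refl = inj₂ (refl , ready t δ , refl)

  final-represents-final : ∀ {x q} → x ≈ q → q ↓ → LTS.Final Machine x
  final-represents-final (ready s δ) (parT c _) = control-final⁻ s (head δ) c
  final-represents-final (writing _ _ _ _) (parT () _)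
  final-represents-final (moving _ _ _)    (parT () _)
  final-represents-final (reading t δ)     (parT c _) = ⊥-elim (await-¬↓ t c)

  ℛ : Conf → LTS.State Spec → Set
  ℛ x Q = x ≈ proj₁ Q

  settle-in-Spec : ∀ {s δ} (Q : LTS.State Spec) → ℛ (s , δ) Q →
                   Σ (Reach (initialExpr M) (Ready s δ)) λ ρ → Taus Spec Q (Ready s δ , ρ)
  settle-in-Spec Q rel = lift-taus Q (settle rel)

  simulate : ∀ {x a y} (Q : LTS.State Spec) → ℛ x Q → x ⇒[ a ] y →
             ∃[ Q'' ] ∃[ Q' ] (Taus Spec Q Q'' × LTS._—[_]→_ Spec Q'' a Q' × ℛ x Q'' × ℛ y Q')
  simulate {s , δ} Q rel (tr , tr∈ , src≡ , rd≡ , refl , refl , refl)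
    with settle-in-Spec Q rel
  ... | ρ , path = (Ready s δ , ρ) , (_ , ρ ◅◅ ((_ , st) ◅ ε)) , path , st , ready s δ ,
                   writing (wr tr) (dr tr) (tgt tr) δ
    where st = ready-step tr tr∈ src≡ rd≡

  cond1 : ∀ {x Q a y} → ℛ x Q → x ⇒[ a ] y →
          ∃[ Q'' ] ∃[ Q' ] (Taus Spec Q Q'' × OptStep Spec Q'' a Q' × ℛ x Q'' × ℛ y Q')
  cond1 {Q = Q} rel st with simulate Q rel st
  ... | Q'' , Q' , path , st' , rel'' , rel' = Q'' , Q' , path , inj₁ st' , rel'' , rel'

  cond2 : ∀ {x Q a Q'} → ℛ x Q → LTS._—[_]→_ Spec Q a Q' →
          ∃[ x'' ] ∃[ x' ] (Taus Machine x x'' × OptStep Machine x'' a x' × ℛ x'' Q × ℛ x' Q')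
  cond2 rel st with classify rel st
  ... | inj₁ (y , st' , rel')   = _ , y , ε , inj₁ st' , rel , rel'
  ... | inj₂ (refl , rel' , _) = _ , _ , ε , inj₂ (refl , refl) , rel , rel'

  cond3 : ∀ {x Q} → ℛ x Q → LTS.Final Machine x →
          ∃[ Q' ] (Taus Spec Q Q' × LTS.Final Spec Q' × ℛ x Q')
  cond3 {s , δ} {Q} rel fin with settle-in-Spec Q rel
  ... | ρ , path = (Ready s δ , ρ) , path ,
                   parT (control-final s (head δ) fin) (tape-final δ) , ready s δ

  cond4 : ∀ {x Q} → ℛ x Q → LTS.Final Spec Q →
          ∃[ x' ] (Taus Machine x x' × LTS.Final Machine x' × ℛ x' Q)
  cond4 rel fin = _ , ε , final-represents-final rel fin , rel

  cond5 : ∀ {x Q} → ℛ x Q → (f : ℕ → Conf) → f 0 ≡ x →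
          (∀ n → f n ⇒[ τ ] f (suc n)) → (∀ n → ℛ (f n) Q) →
          ∃[ Q' ] (Taus⁺ Spec Q Q' × ∃[ k ] ℛ (f k) Q')
  cond5 {Q = Q} rel f refl steps _ with simulate Q rel (steps 0)
  ... | _ , Q' , path , st , _ , rel' = Q' , taus-then-step Spec path st , 1 , rel'

  -- Along a τ-divergence of the encoding, administrative steps lower the rank,
  -- so within rank-many steps a machine τ-step is met.
  module _ (g : ℕ → LTS.State Spec)
           (steps : ∀ n → LTS._—[_]→_ Spec (g n) τ (g (suc n))) where
    reach-machine-step : ∀ n k {x} (rel : ℛ x (g k)) → rank rel ≡ n →
                         ∃[ x' ] (Taus⁺ Machine x x' × ∃[ j ] ℛ x' (g j))
    reach-machine-step n k rel rank≡ with classify rel (steps k)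
    reach-machine-step n k rel rank≡ | inj₁ (y , st , rel') = y , (y , st , ε) , suc k , rel'
    reach-machine-step zero k rel rank≡ | inj₂ (_ , _ , dec) =
      ⊥-elim (0≢1+n (≡-trans (≡-sym rank≡) dec))
    reach-machine-step (suc n) k rel rank≡ | inj₂ (_ , rel' , dec) =
      reach-machine-step n (suc k) rel' (suc-injective (≡-trans (≡-sym dec) rank≡))

  cond6 : ∀ {x Q} → ℛ x Q → (g : ℕ → LTS.State Spec) → g 0 ≡ Q →
          (∀ n → LTS._—[_]→_ Spec (g n) τ (g (suc n))) → (∀ n → ℛ x (g n)) →
          ∃[ x' ] (Taus⁺ Machine x x' × ∃[ k ] ℛ x' (g k))
  cond6 rel g refl steps _ = reach-machine-step g steps _ 0 rel refl

  bisimulation : IsDPBB Machine Spec ℛ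
  bisimulation = record
    { cond1 = λ {x} {Q} {a} {y} → cond1 {x} {Q} {a} {y}
    ; cond2 = λ {x} {Q} {a} {Q'} → cond2 {x} {Q} {a} {Q'}
    ; cond3 = λ {x} {Q} → cond3 {x} {Q}
    ; cond4 = λ {x} {Q} → cond4 {x} {Q}
    ; cond5 = λ {x} {Q} → cond5 {x} {Q}
    ; cond6 = λ {x} {Q} → cond6 {x} {Q}
    }

  initial-related : ℛ (LTS.init Machine) (LTS.init Spec)
  initial-related = ready (RTM.start M) blankTape

theorem5 : (nA nD : ℕ) (M : RTM nA nD) → 𝒯 M ↔bΔ 𝒯spec M
theorem5 nA nD M = ℛ , bisimulation , initial-related
  where open Encoding M
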